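{- Let $p:\mathbb E\to\mathbb B$ be a fibration with fibred small products such that $\mathbb B$ has small products, and let $\mathcal T=(T,\eta,\mu)$ be a monad on $\mathbb B$. Let $R\in\mathbb B$ and $S\in\mathbb E_{TR}$ be a single lifting parameter. Then the functor part $T^{\top\top}$ of the codensity lifting of $\mathcal T$ with this lifting parameter satisfies, for every $X\in\mathbb E$, $$T^{\top\top}X\cong\bigwedge_{f\in\mathbb E(X,S)}((pf)^\#)^{ -1}(S),$$ where $(pf)^\#=\mu_R\circ T(pf):T(pX)\to TR$ is the Kleisli extension, $(-)^{ -1}$ denotes inverse image (reindexing) along $p$, and $\bigwedge$ denotes the fibred product in the fibre $\mathbb E_{T(pX)}$.
   Context: A single lifting parameter $(R,S)$ with $R\in\mathbb B$, $S\in\mathbb E_{TR}$ (the fibre over $TR$) means the lifting parameter with $\mathbb A=1$, $R$ picking $JR\in\mathbb B_{\mathcal T}$ and $S$ picking $S$; under the hypotheses $\mathbb E$ has small products preserved by $p$, so $(p,S)$ satisfies the codensity condition. The codensity lifting: with $J\dashv K$ the Kleisli resolution, counit $\epsilon$, $(\mathrm{Ran}_SS,c)$ the right Kan extension of $S$ along $S$ (preserved by $p$), and $\overline{(-)}$ the inverse of the bijection $\beta\mapsto pc\bullet\beta S$ from natural transformations $H\to p\,\mathrm{Ran}_SS$ to natural transformations $HS\to pS$, the functor $T^{\top\top}$ is the domain of a cartesian lifting $\sigma:T^{\top\top}\to\mathrm{Ran}_SS$ of $\overline{K\epsilon R}:Tp\to p\,\mathrm{Ran}_SS$ (where $K\epsilon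 R:TpS=KJKR\to KR=pS$) in the fibration $[\mathbb E,p]:[\mathbb E,\mathbb E]\to[\mathbb E,\mathbb B]$. -}

module Defs where

open import Level using (Level; _⊔_) renaming (suc to lsuc)
open import Data.Product using (Σ; _,_; proj₁; proj₂; _×_)
open import Data.Product.Properties using (Σ-≡,≡→≡)
open import Relation.Binary.PropositionalEquality
  using (_≡_; refl; sym; trans; cong; cong₂; subst)

record Category (o ℓ : Level) : Set (lsuc (o ⊔ ℓ)) where
  infixr 9 _∘_
  field
    Obj       : Set o
    Hom       : Obj → Obj → Set ℓ
    id        : ∀ {A} → Hom A A
    _∘_       : ∀ {A B C} → Hom B C → Hom A B → Hom A C
    identityˡ : ∀ {A B} {f : Hom A B} → id ∘ f ≡ f
    identityʳ : ∀ {A B} {f : Hom A B} → f ∘ id ≡ f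
    assoc     : ∀ {A B C D} {f : Hom A B} {g : Hom B C} {h : Hom C D} →
                (h ∘ g) ∘ f ≡ h ∘ (g ∘ f)

record Functor {o ℓ o′ ℓ′ : Level} (C : Category o ℓ) (D : Category o′ ℓ′)
       : Set (o ⊔ ℓ ⊔ o′ ⊔ ℓ′) where
  private
    module C = Category C
    module D = Category D
  field
    F₀           : C.Obj → D.Obj
    F₁           : ∀ {A B} → C.Hom A B → D.Hom (F₀ A) (F₀ B)
    identity     : ∀ {A} → F₁ (C.id {A}) ≡ D.id
    homomorphism : ∀ {A B E} {f : C.Hom A B} {g : C.Hom B E} →
                   F₁ (g C.∘ f) ≡ F₁ g D.∘ F₁ f

record NatTrans {o ℓ o′ ℓ′ : Level} {C : Category o ℓ} {D : Category o′ ℓ′}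
       (F G : Functor C D) : Set (o ⊔ ℓ ⊔ o′ ⊔ ℓ′) where
  private
    module C = Category C
    module D = Category D
    module F = Functor F
    module G = Functor G
  field
    η       : ∀ X → D.Hom (F.F₀ X) (G.F₀ X)
    commute : ∀ {X Y} (f : C.Hom X Y) → η Y D.∘ F.F₁ f ≡ G.F₁ f D.∘ η X

_∘F_ : ∀ {o₁ ℓ₁ o₂ ℓ₂ o₃ ℓ₃} {C : Category o₁ ℓ₁} {D : Category o₂ ℓ₂}
       {E : Category o₃ ℓ₃} → Functor D E → Functor C D → Functor C E
_∘F_ {E = E} G F = record
  { F₀ = λ X → G.F₀ (F.F₀ X)
  ; F₁ = λ f → G.F₁ (F.F₁ f)
  ; identity = trans (cong G.F₁ F.identity) G.identity
  ; homomorphism = trans (cong G.F₁ F.homomorphism) G.homomorphism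
  }
  where
    module F = Functor F
    module G = Functor G

idF : ∀ {o ℓ} {C : Category o ℓ} → Functor C C
idF = record { F₀ = λ X → X ; F₁ = λ f → f
             ; identity = refl ; homomorphism = refl }

record Monad {o ℓ : Level} (B : Category o ℓ) : Set (o ⊔ ℓ) where
  open Category B
  field
    T : Functor B B
  open Functor T
  field
    η      : NatTrans idF T
    μ      : NatTrans (T ∘F T) T
  private
    module η = NatTrans η
    module μ = NatTrans μ
  field
    assoc′    : ∀ {X} → μ.η X ∘ F₁ (μ.η X) ≡ μ.η X ∘ μ.η (F₀ X)
    identityˡ′ : ∀ {X} → μ.η X ∘ F₁ (η.η X) ≡ id
    identityʳ′ : ∀ {X} → μ.η X ∘ η.η (F₀ X) ≡ id

-- Categories over B, presented as displayed categories: the fibre of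
-- p : E → B over A is Ob[ A ], and Hom[ f ] X Y are the morphisms of
-- E from X to Y lying over f.  The total category is 𝔼 = Total D and
-- p = π D : Functor (Total D) B is the projection.

record Displayed {o ℓ : Level} (B : Category o ℓ) : Set (lsuc (o ⊔ ℓ)) where
  open Category B
  infixr 9 _∘′_
  field
    Ob[_]  : Obj → Set o
    Hom[_] : ∀ {A C} → Hom A C → Ob[ A ] → Ob[ C ] → Set ℓ
    id′    : ∀ {A} {X : Ob[ A ]} → Hom[ id ] X X
    _∘′_   : ∀ {A C D} {X : Ob[ A ]} {Y : Ob[ C ]} {Z : Ob[ D ]}
             {f : Hom C D} {g : Hom A C} →
             Hom[ f ] Y Z → Hom[ g ] X Y → Hom[ f ∘ g ] X Z
    identityˡ′ : ∀ {A C} {X : Ob[ A ]} {Y : Ob[ C ]} {f : Hom A C}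
                 {ff : Hom[ f ] X Y} →
                 subst (λ h → Hom[ h ] X Y) identityˡ (id′ ∘′ ff) ≡ ff
    identityʳ′ : ∀ {A C} {X : Ob[ A ]} {Y : Ob[ C ]} {f : Hom A C}
                 {ff : Hom[ f ] X Y} →
                 subst (λ h → Hom[ h ] X Y) identityʳ (ff ∘′ id′) ≡ ff
    assoc′     : ∀ {A C D E} {W : Ob[ A ]} {X : Ob[ C ]} {Y : Ob[ D ]}
                 {Z : Ob[ E ]} {f : Hom A C} {g : Hom C D} {h : Hom D E}
                 {ff : Hom[ f ] W X} {gg : Hom[ g ] X Y} {hh : Hom[ h ] Y Z} →
                 subst (λ k → Hom[ k ] W Z) assoc ((hh ∘′ gg) ∘′ ff)
                   ≡ hh ∘′ (gg ∘′ ff)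

module DispUtil {o ℓ : Level} {B : Category o ℓ} (D : Displayed B) where
  open Category B
  open Displayed D

  Total : Category o ℓ
  Total = record
    { Obj = Σ Obj Ob[_]
    ; Hom = λ X Y → Σ (Hom (proj₁ X) (proj₁ Y)) (λ f → Hom[ f ] (proj₂ X) (proj₂ Y))
    ; id = id , id′
    ; _∘_ = λ g f → (proj₁ g ∘ proj₁ f) , (proj₂ g ∘′ proj₂ f)
    ; identityˡ = Σ-≡,≡→≡ (identityˡ , identityˡ′)
    ; identityʳ = Σ-≡,≡→≡ (identityʳ , identityʳ′)
    ; assoc = Σ-≡,≡→≡ (assoc , assoc′)
    }

  π : Functor Total B
  π = record { F₀ = proj₁ ; F₁ = proj₁ ; identity = refl ; homomorphism = refl }

  _≡[_]_ : ∀ {A C} {X : Ob[ A ]} {Y : Ob[ C ]} {f g : Hom A C} →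
           Hom[ f ] X Y → f ≡ g → Hom[ g ] X Y → Set ℓ
  _≡[_]_ {X = X} {Y} ff e gg = subst (λ h → Hom[ h ] X Y) e ff ≡ gg

  IsCartesian : ∀ {A C} {X : Ob[ A ]} {Y : Ob[ C ]} {f : Hom A C} →
                Hom[ f ] X Y → Set (o ⊔ ℓ)
  IsCartesian {A} {C} {X} {Y} {f} ff =
    ∀ {A′} (g : Hom A′ A) (Z : Ob[ A′ ]) (hh : Hom[ f ∘ g ] Z Y) →
    Σ (Hom[ g ] Z X) λ gg → (ff ∘′ gg ≡ hh) ×
      (∀ (gg′ : Hom[ g ] Z X) → ff ∘′ gg′ ≡ hh → gg′ ≡ gg)

  record VerticalIso {A} (X Y : Ob[ A ]) : Set ℓ where
    field
      to      : Hom[ id ] X Y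
      from    : Hom[ id ] Y X
      isoˡ    : (from ∘′ to) ≡[ identityˡ ] id′
      isoʳ    : (to ∘′ from) ≡[ identityˡ ] id′

  IsFibreProduct : ∀ {A} (I : Set ℓ) (X : I → Ob[ A ]) (P : Ob[ A ])
                   (pr : ∀ i → Hom[ id ] P (X i)) → Set (o ⊔ ℓ)
  IsFibreProduct {A} I X P pr =
    ∀ (Z : Ob[ A ]) (h : ∀ i → Hom[ id ] Z (X i)) →
    Σ (Hom[ id ] Z P) λ u → (∀ i → (pr i ∘′ u) ≡[ identityˡ ] h i) ×
      (∀ (u′ : Hom[ id ] Z P) → (∀ i → (pr i ∘′ u′) ≡[ identityˡ ] h i) → u′ ≡ u)

open DispUtil public hiding (_≡[_]_)

record Fibration {o ℓ : Level} {B : Category o ℓ} (D : Displayed B)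
       : Set (o ⊔ ℓ) where
  open Category B
  open Displayed D
  field
    _^*_       : ∀ {A C} (f : Hom A C) → Ob[ C ] → Ob[ A ]
    lift       : ∀ {A C} (f : Hom A C) (Y : Ob[ C ]) → Hom[ f ] (f ^* Y) Y
    lift-cart  : ∀ {A C} (f : Hom A C) (Y : Ob[ C ]) → IsCartesian D (lift f Y)

  reindex : ∀ {A C} (f : Hom A C) {X Y : Ob[ C ]} → Hom[ id ] X Y →
            Hom[ id ] (f ^* X) (f ^* Y)
  reindex f {X} {Y} u =
    proj₁ (lift-cart f Y id (f ^* X)
      (subst (λ h → Hom[ h ] (f ^* X) Y) (trans identityˡ (sym identityʳ))
             (u ∘′ lift f X)))

record FibredProducts {o ℓ : Level} {B : Category o ℓ} {D : Displayed B}
       (F : Fibration D) : Set (lsuc ℓ ⊔ o) where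
  open Category B
  open Displayed D
  open DispUtil D using (_≡[_]_)
  open Fibration F
  field
    ∏    : ∀ {A} (I : Set ℓ) → (I → Ob[ A ]) → Ob[ A ]
    pr   : ∀ {A} (I : Set ℓ) (X : I → Ob[ A ]) (i : I) → Hom[ id ] (∏ I X) (X i)
    isProduct : ∀ {A} (I : Set ℓ) (X : I → Ob[ A ]) → IsFibreProduct D I X (∏ I X) (pr I X)
    stable : ∀ {A C} (f : Hom A C) (I : Set ℓ) (X : I → Ob[ C ]) →
             IsFibreProduct D I (λ i → f ^* X i) (f ^* ∏ I X)
               (λ i → reindex f (pr I X i))

record SmallProducts {o ℓ : Level} (B : Category o ℓ) : Set (lsuc ℓ ⊔ o) where
  open Category B
  field
    ∏    : (I : Set ℓ) → (I → Obj) → Obj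
    pr   : (I : Set ℓ) (X : I → Obj) (i : I) → Hom (∏ I X) (X i)
    isProduct : ∀ (I : Set ℓ) (X : I → Obj) (Z : Obj) (h : ∀ i → Hom Z (X i)) →
      Σ (Hom Z (∏ I X)) λ u → (∀ i → pr I X i ∘ u ≡ h i) ×
        (∀ u′ → (∀ i → pr I X i ∘ u′ ≡ h i) → u′ ≡ u)

-- Functors 𝔼 → 𝔼 lying over T : B → B (i.e. F with p ∘ F = T ∘ p);
-- these are the objects of the fibre of [𝔼,p] : [𝔼,𝔼] → [𝔼,B] over T ∘ p.

record FunctorOver {o ℓ : Level} {B : Category o ℓ} (D : Displayed B)
       (T : Functor B B) : Set (o ⊔ ℓ) where
  open Category B
  open Displayed D
  open DispUtil D using (_≡[_]_)
  private module T = Functor T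
  field
    F₀′ : ∀ {A} → Ob[ A ] → Ob[ T.F₀ A ]
    F₁′ : ∀ {A C} {X : Ob[ A ]} {Y : Ob[ C ]} {f : Hom A C} →
          Hom[ f ] X Y → Hom[ T.F₁ f ] (F₀′ X) (F₀′ Y)
    identity′ : ∀ {A} {X : Ob[ A ]} → (F₁′ (id′ {X = X})) ≡[ T.identity ] id′
    homomorphism′ : ∀ {A C E} {X : Ob[ A ]} {Y : Ob[ C ]} {Z : Ob[ E ]}
                    {f : Hom A C} {g : Hom C E}
                    {ff : Hom[ f ] X Y} {gg : Hom[ g ] Y Z} →
                    F₁′ (gg ∘′ ff) ≡[ T.homomorphism ] (F₁′ gg ∘′ F₁′ ff)

totalF : ∀ {o ℓ} {B : Category o ℓ} {D : Displayed B} {T : Functor B B} →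
         FunctorOver D T → Functor (Total D) (Total D)
totalF {T = T} F = record
  { F₀ = λ X → T.F₀ (proj₁ X) , F₀′ (proj₂ X)
  ; F₁ = λ f → T.F₁ (proj₁ f) , F₁′ (proj₂ f)
  ; identity = Σ-≡,≡→≡ (T.identity , identity′)
  ; homomorphism = Σ-≡,≡→≡ (T.homomorphism , homomorphism′)
  }
  where
    module T = Functor T
    open FunctorOver F

-- Right Kan extension of the functor S : 1 → C along itself
-- (a natural transformation H ∘ S ⇒ S is a single morphism H S → S).

record RanAlongSelf {o ℓ : Level} (C : Category o ℓ) (S : Category.Obj C)
       : Set (o ⊔ ℓ) where
  open Category C
  field
    Ran : Functor C C
    c   : Hom (Functor.F₀ Ran S) S
    universal : ∀ (H : Functor C C) (α : Hom (Functor.F₀ H S) S) →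
      Σ (NatTrans H Ran) λ θ → (c ∘ NatTrans.η θ S ≡ α) ×
        (∀ (θ′ : NatTrans H Ran) → c ∘ NatTrans.η θ′ S ≡ α →
           ∀ X → NatTrans.η θ′ X ≡ NatTrans.η θ X)

-- The functor part of the codensity lifting of a monad M on B along the
-- single lifting parameter (R , S), S ∈ 𝔼_{TR}, computed with the right
-- Kan extension K of S along S.
--
--  * β : T p ⇒ p Ran is \overline{KεR}, i.e. the (unique, as p preserves
--    the Kan extension) natural transformation with  p c • β S = KεR,
--    where KεR : T p S = T T R → T R = p S is μ_R.
--  * T⊤⊤ is a functor 𝔼 → 𝔼 over T (so p T⊤⊤ = T p) and
--    σ : T⊤⊤ ⇒ Ran is a cartesian morphism over β in the fibration
--    [𝔼,p] : [𝔼,𝔼] → [𝔼,B].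

record CodensityLifting {o ℓ : Level} {B : Category o ℓ} (D : Displayed B)
       (M : Monad B) (R : Category.Obj B)
       (S : Displayed.Ob[_] D (Functor.F₀ (Monad.T M) R))
       (K : RanAlongSelf (Total D) (Functor.F₀ (Monad.T M) R , S))
       : Set (lsuc (o ⊔ ℓ)) where
  open Category B
  private
    module T = Functor (Monad.T M)
    module μ = NatTrans (Monad.μ M)
    module K = RanAlongSelf K
    module 𝔼 = Category (Total D)
    p = π D
  field
    β      : NatTrans (Monad.T M ∘F p) (p ∘F K.Ran)
    β-def  : proj₁ K.c ∘ NatTrans.η β (T.F₀ R , S) ≡ μ.η R
    T⊤⊤    : FunctorOver D (Monad.T M)
    σ      : NatTrans (totalF T⊤⊤) K.Ran
    σ-over : ∀ X → proj₁ (NatTrans.η σ X) ≡ NatTrans.η β X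
    σ-cartesian :
      ∀ (G : Functor (Total D) (Total D)) (τ : NatTrans G K.Ran)
        (γ : NatTrans (p ∘F G) (Monad.T M ∘F p)) →
      (∀ X → NatTrans.η β X ∘ NatTrans.η γ X ≡ proj₁ (NatTrans.η τ X)) →
      Σ (NatTrans G (totalF T⊤⊤)) λ θ →
        (∀ X → proj₁ (NatTrans.η θ X) ≡ NatTrans.η γ X) ×
        (∀ X → NatTrans.η σ X 𝔼.∘ NatTrans.η θ X ≡ NatTrans.η τ X) ×
        (∀ (θ′ : NatTrans G (totalF T⊤⊤)) →
           (∀ X → proj₁ (NatTrans.η θ′ X) ≡ NatTrans.η γ X) →
           (∀ X → NatTrans.η σ X 𝔼.∘ NatTrans.η θ′ X ≡ NatTrans.η τ X) →
           ∀ X → NatTrans.η θ′ X ≡ NatTrans.η θ X)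

-- The right-hand side Formula X = ⋀_{f : X → S} ((pf)^♯)^*(S) is a functor
-- 𝔼 → 𝔼 over T p, characterised by a joint cartesian property of its
-- projections. Since 𝔼 has fibred products and B has products, Ran_S S is a
-- retract of the limit formula X ↦ ∏_{f : X → S} S, so the evaluations
-- ev f = c ∘ Ran f are jointly monic already in B. The universal property of
-- Ran gives τ : Formula ⇒ Ran with ev f ∘ τ = the f-th projection, and joint
-- monicity shows τ lies over β; cartesianness of σ turns τ into a vertical
-- θ : Formula ⇒ T⊤⊤ with σ θ = τ. Conversely, p (ev f ∘ σ) = (pf)^♯ because
-- p c ∘ β S = μ_R, so the family ev f ∘ σ factors vertically through
-- Formula. The uniqueness clauses of Ran, of σ and of Formula make the two
-- maps inverse.

module Submission where

open import Defs
open import Level using (Level; _⊔_)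
open import Data.Product using (_,_; proj₁; proj₂)
open import Data.Product.Properties using (Σ-≡,≡→≡)
open import Data.Unit using (⊤; tt)
open import Relation.Binary.PropositionalEquality
open ≡-Reasoning

module _ {o ℓ o′ ℓ′} {C : Category o ℓ} {D : Category o′ ℓ′} where
  open Category D

  idNT : {F : Functor C D} → NatTrans F F
  idNT = record { η = λ _ → id ; commute = λ _ → trans identityˡ (sym identityʳ) }

  infixr 9 _∘ᵥ_
  _∘ᵥ_ : {F G H : Functor C D} → NatTrans G H → NatTrans F G → NatTrans F H
  _∘ᵥ_ {F} {G} {H} b a = record { η = λ X → b.η X ∘ a.η X ; commute = commute }
    where
      module a = NatTrans a
      module b = NatTrans b
      commute : ∀ {X Y} (f : Category.Hom C X Y) →
                (b.η Y ∘ a.η Y) ∘ Functor.F₁ F f ≡ Functor.F₁ H f ∘ (b.η X ∘ a.η X)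
      commute {X} {Y} f = begin
        (b.η Y ∘ a.η Y) ∘ Functor.F₁ F f   ≡⟨ assoc ⟩
        b.η Y ∘ (a.η Y ∘ Functor.F₁ F f)   ≡⟨ cong (b.η Y ∘_) (a.commute f) ⟩
        b.η Y ∘ (Functor.F₁ G f ∘ a.η X)   ≡⟨ sym assoc ⟩
        (b.η Y ∘ Functor.F₁ G f) ∘ a.η X   ≡⟨ cong (_∘ a.η X) (b.commute f) ⟩
        (Functor.F₁ H f ∘ b.η X) ∘ a.η X   ≡⟨ assoc ⟩
        Functor.F₁ H f ∘ (b.η X ∘ a.η X)   ∎

module _ {o ℓ} {C : Category o ℓ} where
  open Category C

  section-monic : ∀ {X Y Z} {r : Hom Y X} {s : Hom X Y} (u v : Hom Z X) →
                  r ∘ s ≡ id → s ∘ u ≡ s ∘ v → u ≡ v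
  section-monic {r = r} {s} u v rs e = begin
    u             ≡⟨ sym identityˡ ⟩
    id ∘ u        ≡⟨ cong (_∘ u) (sym rs) ⟩
    (r ∘ s) ∘ u   ≡⟨ assoc ⟩
    r ∘ (s ∘ u)   ≡⟨ cong (r ∘_) e ⟩
    r ∘ (s ∘ v)   ≡⟨ sym assoc ⟩
    (r ∘ s) ∘ v   ≡⟨ cong (_∘ v) rs ⟩
    id ∘ v        ≡⟨ identityˡ ⟩
    v             ∎

  module _ {S : Obj} (K : RanAlongSelf C S) where
    open RanAlongSelf K

    Ran-unique : {H : Functor C C} (θ θ′ : NatTrans H Ran) →
                 c ∘ NatTrans.η θ S ≡ c ∘ NatTrans.η θ′ S →
                 ∀ X → NatTrans.η θ X ≡ NatTrans.η θ′ X
    Ran-unique {H} θ θ′ e X = trans (unique θ e X) (sym (unique θ′ refl X))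
      where
        unique : ∀ (θ″ : NatTrans H Ran) → c ∘ NatTrans.η θ″ S ≡ c ∘ NatTrans.η θ′ S →
                 ∀ X → NatTrans.η θ″ X ≡ NatTrans.η (proj₁ (universal H (c ∘ NatTrans.η θ′ S))) X
        unique = proj₂ (proj₂ (universal H (c ∘ NatTrans.η θ′ S)))

module SmallProductsProperties {o ℓ} {B : Category o ℓ} (BP : SmallProducts B) where
  open Category B
  open SmallProducts BP

  tuple : ∀ {I : Set ℓ} {X : I → Obj} {Z} → (∀ i → Hom Z (X i)) → Hom Z (∏ I X)
  tuple h = proj₁ (isProduct _ _ _ h)

  pr∘tuple : ∀ {I : Set ℓ} {X : I → Obj} {Z} (h : ∀ i → Hom Z (X i)) i →
             pr I X i ∘ tuple h ≡ h i
  pr∘tuple h = proj₁ (proj₂ (isProduct _ _ _ h))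

  tuple-unique : ∀ {I : Set ℓ} {X : I → Obj} {Z} (h : ∀ i → Hom Z (X i)) u →
                 (∀ i → pr I X i ∘ u ≡ h i) → u ≡ tuple h
  tuple-unique h = proj₂ (proj₂ (isProduct _ _ _ h))

  pr-jointly-monic : ∀ {I : Set ℓ} {X : I → Obj} {Z} (u v : Hom Z (∏ I X)) →
                     (∀ i → pr I X i ∘ u ≡ pr I X i ∘ v) → u ≡ v
  pr-jointly-monic u v e = trans (tuple-unique _ u e) (sym (tuple-unique _ v (λ _ → refl)))

module Fibred {o ℓ} {B : Category o ℓ} (D : Displayed B) (F : Fibration D)
              (FP : FibredProducts F) where
  open Category B
  open Displayed D
  open DispUtil D using (_≡[_]_)
  open Fibration F
  open FibredProducts FP
  module 𝔼 = Category (Total D)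

  ≡-over⁻¹ : ∀ {A C} {X : Ob[ A ]} {Y : Ob[ C ]} {f g : Hom A C}
             {x : Hom[ f ] X Y} {y : Hom[ g ] X Y} (e : f ≡ g) →
             _≡_ {A = 𝔼.Hom (A , X) (C , Y)} (f , x) (g , y) → x ≡[ e ] y
  ≡-over⁻¹ refl refl = refl

  vertical : ∀ {A} {X Y : Ob[ A ]} (χ : 𝔼.Hom (A , X) (A , Y)) → proj₁ χ ≡ id →
             Hom[ id ] X Y
  vertical χ e = subst (λ h → Hom[ h ] _ _) e (proj₂ χ)

  vertical-≡ : ∀ {A} {X Y : Ob[ A ]} (χ : 𝔼.Hom (A , X) (A , Y)) (e : proj₁ χ ≡ id) →
               (id , vertical χ e) ≡ χ
  vertical-≡ _ refl = refl

  vertical-∘ : ∀ {A} {X Y Z : Ob[ A ]}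
               {a : Hom[ id ] Y Z} {b : Hom[ id ] X Y} {c : Hom[ id ] X Z} →
               (a ∘′ b) ≡[ identityˡ ] c → (id , a) 𝔼.∘ (id , b) ≡ (id , c)
  vertical-∘ e = Σ-≡,≡→≡ (identityˡ , e)

  vertical-∘⁻¹ : ∀ {A} {X Y Z : Ob[ A ]}
                 {a : Hom[ id ] Y Z} {b : Hom[ id ] X Y} {c : Hom[ id ] X Z} →
                 (id , a) 𝔼.∘ (id , b) ≡ (id , c) → (a ∘′ b) ≡[ identityˡ ] c
  vertical-∘⁻¹ = ≡-over⁻¹ identityˡ

  verticalIso : ∀ {A} {X Y : Ob[ A ]}
                (χ : 𝔼.Hom (A , X) (A , Y)) (χ-over : proj₁ χ ≡ id)
                (ω : 𝔼.Hom (A , Y) (A , X)) (ω-over : proj₁ ω ≡ id) →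
                ω 𝔼.∘ χ ≡ 𝔼.id → χ 𝔼.∘ ω ≡ 𝔼.id → VerticalIso D X Y
  verticalIso χ χ-over ω ω-over ωχ χω = record
    { to   = vertical χ χ-over
    ; from = vertical ω ω-over
    ; isoˡ = vertical-∘⁻¹ (trans (cong₂ 𝔼._∘_ (vertical-≡ ω ω-over) (vertical-≡ χ χ-over)) ωχ)
    ; isoʳ = vertical-∘⁻¹ (trans (cong₂ 𝔼._∘_ (vertical-≡ χ χ-over) (vertical-≡ ω ω-over)) χω)
    }

  record IsJointlyCartesian {ι} {I : Set ι} {P : 𝔼.Obj} {Y : I → 𝔼.Obj}
         (φ : ∀ i → 𝔼.Hom P (Y i)) : Set (o ⊔ ℓ ⊔ ι) where
    field
      factor : ∀ {Z} (g : Hom (proj₁ Z) (proj₁ P)) (ψ : ∀ i → 𝔼.Hom Z (Y i)) →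
               (∀ i → proj₁ (ψ i) ≡ proj₁ (φ i) ∘ g) → 𝔼.Hom Z P
      factor-over : ∀ {Z g ψ} (e : ∀ i → proj₁ (ψ i) ≡ proj₁ (φ i) ∘ g) →
                    proj₁ (factor {Z} g ψ e) ≡ g
      φ∘factor : ∀ {Z g ψ} (e : ∀ i → proj₁ (ψ i) ≡ proj₁ (φ i) ∘ g) i →
                 φ i 𝔼.∘ factor {Z} g ψ e ≡ ψ i
      factor-unique : ∀ {Z g ψ} (e : ∀ i → proj₁ (ψ i) ≡ proj₁ (φ i) ∘ g)
                      (χ : 𝔼.Hom Z P) → proj₁ χ ≡ g → (∀ i → φ i 𝔼.∘ χ ≡ ψ i) →
                      χ ≡ factor g ψ e

    jointly-monic : ∀ {Z} (χ χ′ : 𝔼.Hom Z P) → proj₁ χ ≡ proj₁ χ′ →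
                    (∀ i → φ i 𝔼.∘ χ ≡ φ i 𝔼.∘ χ′) → χ ≡ χ′
    jointly-monic χ χ′ e h =
      trans (factor-unique over χ e h) (sym (factor-unique over χ′ refl (λ _ → refl)))
      where
        over : ∀ i → proj₁ (φ i 𝔼.∘ χ′) ≡ proj₁ (φ i) ∘ proj₁ χ′
        over _ = refl

  IsCartesianMorphism : ∀ {X Y : 𝔼.Obj} → 𝔼.Hom X Y → Set (o ⊔ ℓ)
  IsCartesianMorphism φ = IsJointlyCartesian {I = ⊤} (λ _ → φ)

  lift-cartesian : ∀ {A C} (f : Hom A C) (Y : Ob[ C ]) → IsCartesianMorphism (f , lift f Y)
  lift-cartesian {A} {C} f Y = record
    { factor = λ g ψ e → g , mediator g ψ e
    ; factor-over = λ _ → refl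
    ; φ∘factor = commutes
    ; factor-unique = unique
    }
    where
      transported : ∀ {Z} (g : Hom (proj₁ Z) A) (ψ : ⊤ → 𝔼.Hom Z (C , Y)) →
                    (⊤ → proj₁ (ψ tt) ≡ f ∘ g) → Hom[ f ∘ g ] (proj₂ Z) Y
      transported g ψ e = subst (λ h → Hom[ h ] _ Y) (e tt) (proj₂ (ψ tt))
      mediator : ∀ {Z} (g : Hom (proj₁ Z) A) (ψ : ⊤ → 𝔼.Hom Z (C , Y)) →
                 (⊤ → proj₁ (ψ tt) ≡ f ∘ g) → Hom[ g ] (proj₂ Z) (f ^* Y)
      mediator {Z} g ψ e = proj₁ (lift-cart f Y g (proj₂ Z) (transported g ψ e))
      commutes : ∀ {Z} {g : Hom (proj₁ Z) A} {ψ : ⊤ → 𝔼.Hom Z (C , Y)}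
                 (e : ⊤ → proj₁ (ψ tt) ≡ f ∘ g) (i : ⊤) →
                 (f , lift f Y) 𝔼.∘ (g , mediator g ψ e) ≡ ψ i
      commutes {Z} {g} {ψ} e tt =
        trans (cong (f ∘ g ,_) (proj₁ (proj₂ (lift-cart f Y g (proj₂ Z) (transported g ψ e)))))
              (sym (Σ-≡,≡→≡ (e tt , refl)))
      unique : ∀ {Z} {g : Hom (proj₁ Z) A} {ψ : ⊤ → 𝔼.Hom Z (C , Y)}
               (e : ⊤ → proj₁ (ψ tt) ≡ f ∘ g) (χ : 𝔼.Hom Z (A , f ^* Y)) → proj₁ χ ≡ g →
               (⊤ → (f , lift f Y) 𝔼.∘ χ ≡ ψ tt) → χ ≡ (g , mediator g ψ e)
      unique {Z} {g} {ψ} e (_ , χ₂) refl h =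
        cong (g ,_) (proj₂ (proj₂ (lift-cart f Y g (proj₂ Z) (transported g ψ e))) χ₂
                      (sym (≡-over⁻¹ (e tt) (sym (h tt)))))

  ∘-jointly-cartesian : ∀ {ι} {I : Set ι} {P : 𝔼.Obj} {Y W : I → 𝔼.Obj}
                        {φ : ∀ i → 𝔼.Hom P (Y i)} {ρ : ∀ i → 𝔼.Hom (Y i) (W i)} →
                        (∀ i → IsCartesianMorphism (ρ i)) → IsJointlyCartesian φ →
                        IsJointlyCartesian (λ i → ρ i 𝔼.∘ φ i)
  ∘-jointly-cartesian {Y = Y} {W} {φ} {ρ} ρ-cart φ-cart = record
    { factor = λ g ψ e → J.factor g (throughρ g ψ e) (λ i → ρ.factor-over i _)
    ; factor-over = λ _ → J.factor-over _
    ; φ∘factor = λ e i → trans 𝔼.assoc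
        (trans (cong (ρ i 𝔼.∘_) (J.φ∘factor _ i)) (ρ.φ∘factor i _ tt))
    ; factor-unique = λ e χ over h → J.factor-unique _ χ over (λ i →
        ρ.factor-unique i _ (φ i 𝔼.∘ χ) (cong (proj₁ (φ i) ∘_) over)
          (λ _ → trans (sym 𝔼.assoc) (h i)))
    }
    where
      module J = IsJointlyCartesian φ-cart
      module ρ i = IsJointlyCartesian (ρ-cart i)
      throughρ : ∀ {Z} g (ψ : ∀ i → 𝔼.Hom Z (W i)) →
                 (∀ i → proj₁ (ψ i) ≡ (proj₁ (ρ i) ∘ proj₁ (φ i)) ∘ g) → ∀ i → 𝔼.Hom Z (Y i)
      throughρ g ψ e i = ρ.factor i (proj₁ (φ i) ∘ g) (λ _ → ψ i) (λ _ → trans (e i) assoc)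

  reindex-square : ∀ {A C} (g : Hom C A) {X Y : Ob[ A ]} (u : Hom[ id ] X Y) →
                   (g , lift g Y) 𝔼.∘ (id , reindex g u) ≡ (id , u) 𝔼.∘ (g , lift g X)
  reindex-square g {X} {Y} u =
    trans (cong (g ∘ id ,_) (proj₁ (proj₂ (lift-cart g Y id (g ^* X) transported))))
          (sym (Σ-≡,≡→≡ (e , refl)))
    where
      e : id ∘ g ≡ g ∘ id
      e = trans identityˡ (sym identityʳ)
      transported : Hom[ g ∘ id ] (g ^* X) Y
      transported = subst (λ h → Hom[ h ] (g ^* X) Y) e (u ∘′ lift g X)

  -- Factor each component through the cartesian lift along g, then use that
  -- reindexing along g preserves the fibre product.
  module ∏-factorisation {A} (I : Set ℓ) (X : I → Ob[ A ]) {Z : 𝔼.Obj}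
         (g : Hom (proj₁ Z) A) (ψ : ∀ i → 𝔼.Hom Z (A , X i))
         (e : ∀ i → proj₁ (ψ i) ≡ id ∘ g) where
    private
      P : Ob[ A ]
      P = ∏ I X
      module Lift (i : I) = IsJointlyCartesian (lift-cartesian g (X i))
      module LiftP = IsJointlyCartesian (lift-cartesian g P)

      ψ-over : ∀ i → ⊤ → proj₁ (ψ i) ≡ g ∘ id
      ψ-over i _ = trans (e i) (trans identityˡ (sym identityʳ))

      toLift : ∀ i → 𝔼.Hom Z (proj₁ Z , g ^* X i)
      toLift i = Lift.factor i id (λ _ → ψ i) (ψ-over i)

      toLift-vertical : ∀ i → Hom[ id ] (proj₂ Z) (g ^* X i)
      toLift-vertical i = vertical (toLift i) (Lift.factor-over i {ψ = λ _ → ψ i} (ψ-over i))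

      stable-product : IsFibreProduct D I (λ i → g ^* X i) (g ^* P) (λ i → reindex g (pr I X i))
      stable-product = stable g I X

      mediator : Hom[ id ] (proj₂ Z) (g ^* P)
      mediator = proj₁ (stable-product (proj₂ Z) toLift-vertical)

    glue : 𝔼.Hom Z (A , P)
    glue = (g , lift g P) 𝔼.∘ (id , mediator)

    glue-commutes : ∀ i → (id , pr I X i) 𝔼.∘ glue ≡ ψ i
    glue-commutes i = begin
      (id , pr I X i) 𝔼.∘ ((g , lift g P) 𝔼.∘ (id , mediator))
        ≡⟨ sym 𝔼.assoc ⟩
      ((id , pr I X i) 𝔼.∘ (g , lift g P)) 𝔼.∘ (id , mediator)
        ≡⟨ cong (𝔼._∘ (id , mediator)) (sym (reindex-square g (pr I X i))) ⟩
      ((g , lift g (X i)) 𝔼.∘ (id , reindex g (pr I X i))) 𝔼.∘ (id , mediator)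
        ≡⟨ 𝔼.assoc ⟩
      (g , lift g (X i)) 𝔼.∘ ((id , reindex g (pr I X i)) 𝔼.∘ (id , mediator))
        ≡⟨ cong ((g , lift g (X i)) 𝔼.∘_)
                (vertical-∘ (proj₁ (proj₂ (stable-product (proj₂ Z) toLift-vertical)) i)) ⟩
      (g , lift g (X i)) 𝔼.∘ (id , toLift-vertical i)
        ≡⟨ cong ((g , lift g (X i)) 𝔼.∘_) (vertical-≡ _ _) ⟩
      (g , lift g (X i)) 𝔼.∘ toLift i
        ≡⟨ Lift.φ∘factor i (ψ-over i) tt ⟩
      ψ i ∎

    glue-unique : (χ : 𝔼.Hom Z (A , P)) → proj₁ χ ≡ g →
                  (∀ i → (id , pr I X i) 𝔼.∘ χ ≡ ψ i) → χ ≡ glue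
    glue-unique χ χ-over h = begin
      χ
        ≡⟨ sym (LiftP.φ∘factor χ-over′ tt) ⟩
      (g , lift g P) 𝔼.∘ ν
        ≡⟨ cong ((g , lift g P) 𝔼.∘_) (sym (vertical-≡ ν ν-over)) ⟩
      (g , lift g P) 𝔼.∘ (id , vertical ν ν-over)
        ≡⟨ cong (λ w → (g , lift g P) 𝔼.∘ (id , w)) ν-factors ⟩
      glue ∎
      where
        χ-over′ : ⊤ → proj₁ χ ≡ g ∘ id
        χ-over′ _ = trans χ-over (sym identityʳ)
        ν : 𝔼.Hom Z (proj₁ Z , g ^* P)
        ν = LiftP.factor id (λ _ → χ) χ-over′
        ν-over : proj₁ ν ≡ id
        ν-over = LiftP.factor-over {ψ = λ _ → χ} χ-over′
        reindex∘ν : ∀ i → (id , reindex g (pr I X i)) 𝔼.∘ ν ≡ toLift i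
        reindex∘ν i = Lift.factor-unique i (ψ-over i) _ (trans identityˡ ν-over) λ _ → begin
          (g , lift g (X i)) 𝔼.∘ ((id , reindex g (pr I X i)) 𝔼.∘ ν)
            ≡⟨ sym 𝔼.assoc ⟩
          ((g , lift g (X i)) 𝔼.∘ (id , reindex g (pr I X i))) 𝔼.∘ ν
            ≡⟨ cong (𝔼._∘ ν) (reindex-square g (pr I X i)) ⟩
          ((id , pr I X i) 𝔼.∘ (g , lift g P)) 𝔼.∘ ν
            ≡⟨ 𝔼.assoc ⟩
          (id , pr I X i) 𝔼.∘ ((g , lift g P) 𝔼.∘ ν)
            ≡⟨ cong ((id , pr I X i) 𝔼.∘_) (LiftP.φ∘factor χ-over′ tt) ⟩
          (id , pr I X i) 𝔼.∘ χ
            ≡⟨ h i ⟩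
          ψ i ∎
        ν-factors : vertical ν ν-over ≡ mediator
        ν-factors = proj₂ (proj₂ (stable-product (proj₂ Z) toLift-vertical)) _ λ i →
          vertical-∘⁻¹ (trans (cong ((id , reindex g (pr I X i)) 𝔼.∘_) (vertical-≡ ν ν-over))
                              (trans (reindex∘ν i) (sym (vertical-≡ _ _))))

  ∏-jointly-cartesian : ∀ {A} (I : Set ℓ) (X : I → Ob[ A ]) →
                        IsJointlyCartesian {P = A , ∏ I X} (λ i → id , pr I X i)
  ∏-jointly-cartesian I X = record
    { factor = ∏-factorisation.glue I X
    ; factor-over = λ _ → identityʳ
    ; φ∘factor = λ {_} {g} {ψ} e → ∏-factorisation.glue-commutes I X g ψ e
    ; factor-unique = λ {_} {g} {ψ} e → ∏-factorisation.glue-unique I X g ψ e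
    }

  module ReindexedProduct (Q : 𝔼.Obj) (G : Functor (Total D) B)
         (k : ∀ X → 𝔼.Hom X Q → Hom (Functor.F₀ G X) (proj₁ Q))
         (k-natural : ∀ {X Y} (g : 𝔼.Hom X Y) (h : 𝔼.Hom Y Q) →
                      k Y h ∘ Functor.F₁ G g ≡ k X (h 𝔼.∘ g)) where
    private module G = Functor G

    Π₀ : 𝔼.Obj → 𝔼.Obj
    Π₀ X = G.F₀ X , ∏ (𝔼.Hom X Q) (λ f → k X f ^* proj₂ Q)

    proj : ∀ X (f : 𝔼.Hom X Q) → 𝔼.Hom (Π₀ X) Q
    proj X f = (k X f , lift (k X f) (proj₂ Q)) 𝔼.∘ (id , pr _ _ f)

    proj-jointly-cartesian : ∀ X → IsJointlyCartesian (proj X)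
    proj-jointly-cartesian X =
      ∘-jointly-cartesian (λ f → lift-cartesian (k X f) (proj₂ Q)) (∏-jointly-cartesian _ _)

    proj-jointly-monic : ∀ {X Z} (χ χ′ : 𝔼.Hom Z (Π₀ X)) → proj₁ χ ≡ proj₁ χ′ →
                         (∀ f → proj X f 𝔼.∘ χ ≡ proj X f 𝔼.∘ χ′) → χ ≡ χ′
    proj-jointly-monic {X} = IsJointlyCartesian.jointly-monic (proj-jointly-cartesian X)

    module _ {X Z : 𝔼.Obj} (g : Hom (proj₁ Z) (G.F₀ X)) (ψ : ∀ f → 𝔼.Hom Z Q)
             (e : ∀ f → proj₁ (ψ f) ≡ k X f ∘ g) where
      private
        module J = IsJointlyCartesian (proj-jointly-cartesian X)
        e′ : ∀ f → proj₁ (ψ f) ≡ proj₁ (proj X f) ∘ g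
        e′ f = trans (e f) (cong (_∘ g) (sym identityʳ))

      tuple : 𝔼.Hom Z (Π₀ X)
      tuple = J.factor g ψ e′

      tuple-over : proj₁ tuple ≡ g
      tuple-over = J.factor-over {g = g} {ψ} e′

      proj∘tuple : ∀ f → proj X f 𝔼.∘ tuple ≡ ψ f
      proj∘tuple = J.φ∘factor {g = g} {ψ} e′

    private
      restrict : ∀ {X Y} (g : 𝔼.Hom X Y) → 𝔼.Hom Y Q → 𝔼.Hom (Π₀ X) Q
      restrict {X} g h = proj X (h 𝔼.∘ g)

      restrict-over : ∀ {X Y} (g : 𝔼.Hom X Y) h → proj₁ (restrict g h) ≡ k Y h ∘ G.F₁ g
      restrict-over g h = trans identityʳ (sym (k-natural g h))

    Π₁ : ∀ {X Y} → 𝔼.Hom X Y → 𝔼.Hom (Π₀ X) (Π₀ Y)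
    Π₁ g = tuple (G.F₁ g) (restrict g) (restrict-over g)

    Π₁-over : ∀ {X Y} (g : 𝔼.Hom X Y) → proj₁ (Π₁ g) ≡ G.F₁ g
    Π₁-over g = tuple-over (G.F₁ g) (restrict g) (restrict-over g)

    proj∘Π₁ : ∀ {X Y} (g : 𝔼.Hom X Y) (h : 𝔼.Hom Y Q) → proj Y h 𝔼.∘ Π₁ g ≡ proj X (h 𝔼.∘ g)
    proj∘Π₁ g = proj∘tuple (G.F₁ g) (restrict g) (restrict-over g)

    Π : Functor (Total D) (Total D)
    Π = record
      { F₀ = Π₀
      ; F₁ = Π₁
      ; identity = λ {X} → proj-jointly-monic _ _ (trans (Π₁-over 𝔼.id) G.identity) λ h →
          trans (proj∘Π₁ 𝔼.id h) (trans (cong (proj X) 𝔼.identityʳ) (sym 𝔼.identityʳ))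
      ; homomorphism = λ {X} {Y} {Z} {g} {g′} → proj-jointly-monic _ _
          (trans (Π₁-over _) (trans G.homomorphism (sym (cong₂ _∘_ (Π₁-over g′) (Π₁-over g)))))
          λ h → begin
            proj Z h 𝔼.∘ Π₁ (g′ 𝔼.∘ g)         ≡⟨ proj∘Π₁ _ h ⟩
            proj X (h 𝔼.∘ (g′ 𝔼.∘ g))          ≡⟨ cong (proj X) (sym 𝔼.assoc) ⟩
            proj X ((h 𝔼.∘ g′) 𝔼.∘ g)          ≡⟨ sym (proj∘Π₁ g _) ⟩
            proj Y (h 𝔼.∘ g′) 𝔼.∘ Π₁ g         ≡⟨ cong (𝔼._∘ Π₁ g) (sym (proj∘Π₁ g′ h)) ⟩
            (proj Z h 𝔼.∘ Π₁ g′) 𝔼.∘ Π₁ g      ≡⟨ 𝔼.assoc ⟩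
            proj Z h 𝔼.∘ (Π₁ g′ 𝔼.∘ Π₁ g)      ∎
      }

module CodensityLiftingFormula {o ℓ : Level} (B : Category o ℓ) (D : Displayed B)
      (F : Fibration D) (FP : FibredProducts F) (BP : SmallProducts B)
      (M : Monad B) (R : Category.Obj B)
      (S : Displayed.Ob[_] D (Functor.F₀ (Monad.T M) R))
      (K : RanAlongSelf (Total D) (Functor.F₀ (Monad.T M) R , S))
      (L : CodensityLifting D M R S K) where
  open Category B
  open Fibred D F FP
  open SmallProductsProperties BP
  open RanAlongSelf K using (Ran; c; universal)
  open CodensityLifting L
  module BP = SmallProducts BP
  module T = Functor (Monad.T M)
  module μ = NatTrans (Monad.μ M)
  module Ran = Functor Ran
  module β = NatTrans β
  module σ = NatTrans σ

  Ŝ : 𝔼.Obj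
  Ŝ = T.F₀ R , S

  𝕋 : Functor (Total D) (Total D)
  𝕋 = totalF T⊤⊤

  module 𝕋 = Functor 𝕋

  _♯ : ∀ {X} → 𝔼.Hom X Ŝ → Hom (T.F₀ (proj₁ X)) (T.F₀ R)
  f ♯ = μ.η R ∘ T.F₁ (proj₁ f)

  ♯-natural : ∀ {X Y} (g : 𝔼.Hom X Y) (h : 𝔼.Hom Y Ŝ) → h ♯ ∘ T.F₁ (proj₁ g) ≡ (h 𝔼.∘ g) ♯
  ♯-natural g h = trans assoc (cong (μ.η R ∘_) (sym T.homomorphism))

  ev : ∀ {X} → 𝔼.Hom X Ŝ → 𝔼.Hom (Ran.F₀ X) Ŝ
  ev f = c 𝔼.∘ Ran.F₁ f

  ev-id : ev 𝔼.id ≡ c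
  ev-id = trans (cong (c 𝔼.∘_) Ran.identity) 𝔼.identityʳ

  ev∘Ran : ∀ {X Y} (g : 𝔼.Hom X Y) (h : 𝔼.Hom Y Ŝ) → ev h 𝔼.∘ Ran.F₁ g ≡ ev (h 𝔼.∘ g)
  ev∘Ran g h = trans 𝔼.assoc (cong (c 𝔼.∘_) (sym Ran.homomorphism))

  ev-β : ∀ {X} (f : 𝔼.Hom X Ŝ) → proj₁ (ev f) ∘ β.η X ≡ f ♯
  ev-β {X} f = begin
    (proj₁ c ∘ proj₁ (Ran.F₁ f)) ∘ β.η X   ≡⟨ assoc ⟩
    proj₁ c ∘ (proj₁ (Ran.F₁ f) ∘ β.η X)   ≡⟨ cong (proj₁ c ∘_) (sym (β.commute f)) ⟩
    proj₁ c ∘ (β.η Ŝ ∘ T.F₁ (proj₁ f))     ≡⟨ sym assoc ⟩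
    (proj₁ c ∘ β.η Ŝ) ∘ T.F₁ (proj₁ f)     ≡⟨ cong (_∘ T.F₁ (proj₁ f)) β-def ⟩
    f ♯                                     ∎

  Power₀ : 𝔼.Obj → Obj
  Power₀ X = BP.∏ (𝔼.Hom X Ŝ) (λ _ → T.F₀ R)

  at : ∀ X → 𝔼.Hom X Ŝ → Hom (Power₀ X) (T.F₀ R)
  at X = BP.pr (𝔼.Hom X Ŝ) (λ _ → T.F₀ R)

  Power₁ : ∀ {X Y} → 𝔼.Hom X Y → Hom (Power₀ X) (Power₀ Y)
  Power₁ {X} g = tuple (λ h → at X (h 𝔼.∘ g))

  at∘Power₁ : ∀ {X Y} (g : 𝔼.Hom X Y) (h : 𝔼.Hom Y Ŝ) → at Y h ∘ Power₁ g ≡ at X (h 𝔼.∘ g)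
  at∘Power₁ {X} g = pr∘tuple (λ h → at X (h 𝔼.∘ g))

  Power : Functor (Total D) B
  Power = record
    { F₀ = Power₀
    ; F₁ = Power₁
    ; identity = λ {X} → pr-jointly-monic _ _ λ h →
        trans (at∘Power₁ 𝔼.id h) (trans (cong (at X) 𝔼.identityʳ) (sym identityʳ))
    ; homomorphism = λ {X} {Y} {Z} {g} {g′} → pr-jointly-monic _ _ λ h → begin
        at Z h ∘ Power₁ (g′ 𝔼.∘ g)          ≡⟨ at∘Power₁ _ h ⟩
        at X (h 𝔼.∘ (g′ 𝔼.∘ g))             ≡⟨ cong (at X) (sym 𝔼.assoc) ⟩
        at X ((h 𝔼.∘ g′) 𝔼.∘ g)             ≡⟨ sym (at∘Power₁ g _) ⟩
        at Y (h 𝔼.∘ g′) ∘ Power₁ g          ≡⟨ cong (_∘ Power₁ g) (sym (at∘Power₁ g′ h)) ⟩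
        (at Z h ∘ Power₁ g′) ∘ Power₁ g     ≡⟨ assoc ⟩
        at Z h ∘ (Power₁ g′ ∘ Power₁ g)     ∎
    }

  -- The limit formula ∏_{f : X → Ŝ} Ŝ for Ran_Ŝ Ŝ. Ran is a retract of it,
  -- which makes the base maps of the evaluations ev f jointly monic.
  module Codensity = ReindexedProduct Ŝ Power at at∘Power₁

  Codensity : Functor (Total D) (Total D)
  Codensity = Codensity.Π

  codensity-jointly-monic : ∀ {X Z} (χ χ′ : 𝔼.Hom Z (Codensity.Π₀ X)) →
                            (∀ f → Codensity.proj X f 𝔼.∘ χ ≡ Codensity.proj X f 𝔼.∘ χ′) →
                            χ ≡ χ′
  codensity-jointly-monic {X} χ χ′ h = Codensity.proj-jointly-monic χ χ′ base h
    where
      base : proj₁ χ ≡ proj₁ χ′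
      base = pr-jointly-monic _ _ λ f → begin
        at X f ∘ proj₁ χ                    ≡⟨ cong (_∘ proj₁ χ) (sym identityʳ) ⟩
        proj₁ (Codensity.proj X f 𝔼.∘ χ)    ≡⟨ cong proj₁ (h f) ⟩
        proj₁ (Codensity.proj X f 𝔼.∘ χ′)   ≡⟨ cong (_∘ proj₁ χ′) identityʳ ⟩
        at X f ∘ proj₁ χ′                   ∎

  evaluations : ∀ X → Hom (proj₁ (Ran.F₀ X)) (Power₀ X)
  evaluations X = tuple (λ f → proj₁ (ev {X} f))

  evaluations-over : ∀ {X} (f : 𝔼.Hom X Ŝ) → proj₁ (ev f) ≡ at X f ∘ evaluations X
  evaluations-over f = sym (pr∘tuple _ f)

  toCodensity₀ : ∀ X → 𝔼.Hom (Ran.F₀ X) (Codensity.Π₀ X)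
  toCodensity₀ X = Codensity.tuple (evaluations X) ev evaluations-over

  proj∘toCodensity : ∀ {X} (f : 𝔼.Hom X Ŝ) → Codensity.proj X f 𝔼.∘ toCodensity₀ X ≡ ev f
  proj∘toCodensity {X} = Codensity.proj∘tuple (evaluations X) ev evaluations-over

  toCodensity-over : ∀ X → proj₁ (toCodensity₀ X) ≡ evaluations X
  toCodensity-over X = Codensity.tuple-over (evaluations X) ev evaluations-over

  toCodensity : NatTrans Ran Codensity
  toCodensity = record { η = toCodensity₀ ; commute = commute }
    where
      s : ∀ X → 𝔼.Hom (Ran.F₀ X) (Codensity.Π₀ X)
      s = toCodensity₀
      commute : ∀ {X Y} (g : 𝔼.Hom X Y) → s Y 𝔼.∘ Ran.F₁ g ≡ Codensity.Π₁ g 𝔼.∘ s X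
      commute {X} {Y} g = codensity-jointly-monic _ _ λ h → begin
        Codensity.proj Y h 𝔼.∘ (s Y 𝔼.∘ Ran.F₁ g)
          ≡⟨ sym 𝔼.assoc ⟩
        (Codensity.proj Y h 𝔼.∘ s Y) 𝔼.∘ Ran.F₁ g
          ≡⟨ cong (𝔼._∘ Ran.F₁ g) (proj∘toCodensity h) ⟩
        ev h 𝔼.∘ Ran.F₁ g
          ≡⟨ ev∘Ran g h ⟩
        ev (h 𝔼.∘ g)
          ≡⟨ sym (proj∘toCodensity (h 𝔼.∘ g)) ⟩
        Codensity.proj X (h 𝔼.∘ g) 𝔼.∘ s X
          ≡⟨ cong (𝔼._∘ s X) (sym (Codensity.proj∘Π₁ g h)) ⟩
        (Codensity.proj Y h 𝔼.∘ Codensity.Π₁ g) 𝔼.∘ s X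
          ≡⟨ 𝔼.assoc ⟩
        Codensity.proj Y h 𝔼.∘ (Codensity.Π₁ g 𝔼.∘ s X) ∎

  fromCodensity : NatTrans Codensity Ran
  fromCodensity = proj₁ (universal Codensity (Codensity.proj Ŝ 𝔼.id))

  c∘fromCodensity : c 𝔼.∘ NatTrans.η fromCodensity Ŝ ≡ Codensity.proj Ŝ 𝔼.id
  c∘fromCodensity = proj₁ (proj₂ (universal Codensity (Codensity.proj Ŝ 𝔼.id)))

  fromCodensity∘toCodensity : ∀ X → NatTrans.η fromCodensity X 𝔼.∘ toCodensity₀ X ≡ 𝔼.id
  fromCodensity∘toCodensity = Ran-unique K (fromCodensity ∘ᵥ toCodensity) idNT at-Ŝ
    where
      r : ∀ X → 𝔼.Hom (Codensity.Π₀ X) (Ran.F₀ X)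
      r = NatTrans.η fromCodensity
      at-Ŝ : c 𝔼.∘ (r Ŝ 𝔼.∘ toCodensity₀ Ŝ) ≡ c 𝔼.∘ 𝔼.id
      at-Ŝ = begin
        c 𝔼.∘ (r Ŝ 𝔼.∘ toCodensity₀ Ŝ)           ≡⟨ sym 𝔼.assoc ⟩
        (c 𝔼.∘ r Ŝ) 𝔼.∘ toCodensity₀ Ŝ           ≡⟨ cong (𝔼._∘ toCodensity₀ Ŝ) c∘fromCodensity ⟩
        Codensity.proj Ŝ 𝔼.id 𝔼.∘ toCodensity₀ Ŝ  ≡⟨ proj∘toCodensity 𝔼.id ⟩
        ev 𝔼.id                                   ≡⟨ ev-id ⟩
        c                                         ≡⟨ sym 𝔼.identityʳ ⟩
        c 𝔼.∘ 𝔼.id                                ∎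

  ev-jointly-monic : ∀ {X Y} (u v : Hom Y (proj₁ (Ran.F₀ X))) →
                     (∀ f → proj₁ (ev f) ∘ u ≡ proj₁ (ev f) ∘ v) → u ≡ v
  ev-jointly-monic {X} u v h =
    section-monic {C = B} u v (cong proj₁ (fromCodensity∘toCodensity X)) (begin
      proj₁ (toCodensity₀ X) ∘ u    ≡⟨ cong (_∘ u) (toCodensity-over X) ⟩
      evaluations X ∘ u             ≡⟨ pr-jointly-monic _ _ evaluations-separate ⟩
      evaluations X ∘ v             ≡⟨ cong (_∘ v) (sym (toCodensity-over X)) ⟩
      proj₁ (toCodensity₀ X) ∘ v    ∎)
    where
      at∘evaluations : ∀ w f → at X f ∘ (evaluations X ∘ w) ≡ proj₁ (ev f) ∘ w
      at∘evaluations w f = trans (sym assoc) (cong (_∘ w) (sym (evaluations-over f)))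
      evaluations-separate : ∀ f → at X f ∘ (evaluations X ∘ u) ≡ at X f ∘ (evaluations X ∘ v)
      evaluations-separate f =
        trans (at∘evaluations u f) (trans (h f) (sym (at∘evaluations v f)))

  σ-unique : ∀ {G : Functor (Total D) (Total D)} (θ θ′ : NatTrans G 𝕋) →
             (∀ X → proj₁ (NatTrans.η θ X) ≡ proj₁ (NatTrans.η θ′ X)) →
             (∀ X → σ.η X 𝔼.∘ NatTrans.η θ X ≡ σ.η X 𝔼.∘ NatTrans.η θ′ X) →
             ∀ X → NatTrans.η θ X ≡ NatTrans.η θ′ X
  σ-unique {G} θ θ′ over commutes X =
    trans (unique θ over commutes X) (sym (unique θ′ (λ _ → refl) (λ _ → refl) X))
    where
      base : NatTrans (π D ∘F G) (Monad.T M ∘F π D)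
      base = record { η = λ X → proj₁ (NatTrans.η θ′ X)
                    ; commute = λ f → cong proj₁ (NatTrans.commute θ′ f) }
      over-β : ∀ X → β.η X ∘ proj₁ (NatTrans.η θ′ X) ≡ proj₁ (NatTrans.η (σ ∘ᵥ θ′) X)
      over-β X = cong (_∘ proj₁ (NatTrans.η θ′ X)) (sym (σ-over X))
      mediator : NatTrans G 𝕋
      mediator = proj₁ (σ-cartesian G (σ ∘ᵥ θ′) base over-β)
      unique : ∀ (θ″ : NatTrans G 𝕋) →
               (∀ X → proj₁ (NatTrans.η θ″ X) ≡ proj₁ (NatTrans.η θ′ X)) →
               (∀ X → σ.η X 𝔼.∘ NatTrans.η θ″ X ≡ σ.η X 𝔼.∘ NatTrans.η θ′ X) →
               ∀ X → NatTrans.η θ″ X ≡ NatTrans.η mediator X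
      unique = proj₂ (proj₂ (proj₂ (σ-cartesian G (σ ∘ᵥ θ′) base over-β)))

  module Formula = ReindexedProduct Ŝ (Monad.T M ∘F π D) (λ _ f → f ♯) ♯-natural

  Formula : Functor (Total D) (Total D)
  Formula = Formula.Π

  formulaToRan : NatTrans Formula Ran
  formulaToRan = proj₁ (universal Formula (Formula.proj Ŝ 𝔼.id))

  formulaToRan₀ : ∀ X → 𝔼.Hom (Formula.Π₀ X) (Ran.F₀ X)
  formulaToRan₀ = NatTrans.η formulaToRan

  c∘formulaToRan : c 𝔼.∘ formulaToRan₀ Ŝ ≡ Formula.proj Ŝ 𝔼.id
  c∘formulaToRan = proj₁ (proj₂ (universal Formula (Formula.proj Ŝ 𝔼.id)))

  ev∘formulaToRan : ∀ {X} (f : 𝔼.Hom X Ŝ) → ev f 𝔼.∘ formulaToRan₀ X ≡ Formula.proj X f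
  ev∘formulaToRan {X} f = begin
    (c 𝔼.∘ Ran.F₁ f) 𝔼.∘ formulaToRan₀ X
      ≡⟨ 𝔼.assoc ⟩
    c 𝔼.∘ (Ran.F₁ f 𝔼.∘ formulaToRan₀ X)
      ≡⟨ cong (c 𝔼.∘_) (sym (NatTrans.commute formulaToRan f)) ⟩
    c 𝔼.∘ (formulaToRan₀ Ŝ 𝔼.∘ Formula.Π₁ f)
      ≡⟨ sym 𝔼.assoc ⟩
    (c 𝔼.∘ formulaToRan₀ Ŝ) 𝔼.∘ Formula.Π₁ f
      ≡⟨ cong (𝔼._∘ Formula.Π₁ f) c∘formulaToRan ⟩
    Formula.proj Ŝ 𝔼.id 𝔼.∘ Formula.Π₁ f
      ≡⟨ Formula.proj∘Π₁ f 𝔼.id ⟩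
    Formula.proj X (𝔼.id 𝔼.∘ f)
      ≡⟨ cong (Formula.proj X) 𝔼.identityˡ ⟩
    Formula.proj X f ∎

  formulaToRan-over : ∀ X → proj₁ (formulaToRan₀ X) ≡ β.η X
  formulaToRan-over X = ev-jointly-monic _ _ λ f →
    trans (cong proj₁ (ev∘formulaToRan f)) (trans identityʳ (sym (ev-β f)))

  formula-base : NatTrans (π D ∘F Formula) (Monad.T M ∘F π D)
  formula-base = record
    { η = λ _ → id
    ; commute = λ f → trans identityˡ (trans (Formula.Π₁-over f) (sym identityʳ)) }

  β∘formula-base : ∀ X → β.η X ∘ id ≡ proj₁ (formulaToRan₀ X)
  β∘formula-base X = trans identityʳ (sym (formulaToRan-over X))

  fromFormula : NatTrans Formula 𝕋
  fromFormula = proj₁ (σ-cartesian Formula formulaToRan formula-base β∘formula-base)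

  fromFormula₀ : ∀ X → 𝔼.Hom (Formula.Π₀ X) (𝕋.F₀ X)
  fromFormula₀ = NatTrans.η fromFormula

  fromFormula-over : ∀ X → proj₁ (fromFormula₀ X) ≡ id
  fromFormula-over =
    proj₁ (proj₂ (σ-cartesian Formula formulaToRan formula-base β∘formula-base))

  σ∘fromFormula : ∀ X → σ.η X 𝔼.∘ fromFormula₀ X ≡ formulaToRan₀ X
  σ∘fromFormula =
    proj₁ (proj₂ (proj₂ (σ-cartesian Formula formulaToRan formula-base β∘formula-base)))

  ev∘σ-over : ∀ X (f : 𝔼.Hom X Ŝ) → proj₁ (ev f 𝔼.∘ σ.η X) ≡ f ♯ ∘ id
  ev∘σ-over X f = begin
    proj₁ (ev f) ∘ proj₁ (σ.η X)   ≡⟨ cong (proj₁ (ev f) ∘_) (σ-over X) ⟩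
    proj₁ (ev f) ∘ β.η X           ≡⟨ ev-β f ⟩
    f ♯                            ≡⟨ sym identityʳ ⟩
    f ♯ ∘ id                       ∎

  toFormula₀ : ∀ X → 𝔼.Hom (𝕋.F₀ X) (Formula.Π₀ X)
  toFormula₀ X = Formula.tuple id (λ f → ev f 𝔼.∘ σ.η X) (ev∘σ-over X)

  toFormula-over : ∀ X → proj₁ (toFormula₀ X) ≡ id
  toFormula-over X = Formula.tuple-over id (λ f → ev f 𝔼.∘ σ.η X) (ev∘σ-over X)

  proj∘toFormula : ∀ {X} (f : 𝔼.Hom X Ŝ) → Formula.proj X f 𝔼.∘ toFormula₀ X ≡ ev f 𝔼.∘ σ.η X
  proj∘toFormula {X} = Formula.proj∘tuple id (λ f → ev f 𝔼.∘ σ.η X) (ev∘σ-over X)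

  toFormula : NatTrans 𝕋 Formula
  toFormula = record { η = toFormula₀ ; commute = commute }
    where
      α : ∀ X → 𝔼.Hom (𝕋.F₀ X) (Formula.Π₀ X)
      α = toFormula₀
      commute : ∀ {X Y} (g : 𝔼.Hom X Y) → α Y 𝔼.∘ 𝕋.F₁ g ≡ Formula.Π₁ g 𝔼.∘ α X
      commute {X} {Y} g = Formula.proj-jointly-monic _ _ base λ h → begin
        Formula.proj Y h 𝔼.∘ (α Y 𝔼.∘ 𝕋.F₁ g)
          ≡⟨ sym 𝔼.assoc ⟩
        (Formula.proj Y h 𝔼.∘ α Y) 𝔼.∘ 𝕋.F₁ g
          ≡⟨ cong (𝔼._∘ 𝕋.F₁ g) (proj∘toFormula h) ⟩
        (ev h 𝔼.∘ σ.η Y) 𝔼.∘ 𝕋.F₁ g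
          ≡⟨ 𝔼.assoc ⟩
        ev h 𝔼.∘ (σ.η Y 𝔼.∘ 𝕋.F₁ g)
          ≡⟨ cong (ev h 𝔼.∘_) (σ.commute g) ⟩
        ev h 𝔼.∘ (Ran.F₁ g 𝔼.∘ σ.η X)
          ≡⟨ sym 𝔼.assoc ⟩
        (ev h 𝔼.∘ Ran.F₁ g) 𝔼.∘ σ.η X
          ≡⟨ cong (𝔼._∘ σ.η X) (ev∘Ran g h) ⟩
        ev (h 𝔼.∘ g) 𝔼.∘ σ.η X
          ≡⟨ sym (proj∘toFormula (h 𝔼.∘ g)) ⟩
        Formula.proj X (h 𝔼.∘ g) 𝔼.∘ α X
          ≡⟨ cong (𝔼._∘ α X) (sym (Formula.proj∘Π₁ g h)) ⟩
        (Formula.proj Y h 𝔼.∘ Formula.Π₁ g) 𝔼.∘ α X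
          ≡⟨ 𝔼.assoc ⟩
        Formula.proj Y h 𝔼.∘ (Formula.Π₁ g 𝔼.∘ α X) ∎
        where
          base : proj₁ (α Y) ∘ T.F₁ (proj₁ g) ≡ proj₁ (Formula.Π₁ g) ∘ proj₁ (α X)
          base = begin
            proj₁ (α Y) ∘ T.F₁ (proj₁ g)
              ≡⟨ cong (_∘ T.F₁ (proj₁ g)) (toFormula-over Y) ⟩
            id ∘ T.F₁ (proj₁ g)
              ≡⟨ identityˡ ⟩
            T.F₁ (proj₁ g)
              ≡⟨ sym identityʳ ⟩
            T.F₁ (proj₁ g) ∘ id
              ≡⟨ sym (cong₂ _∘_ (Formula.Π₁-over g) (toFormula-over X)) ⟩
            proj₁ (Formula.Π₁ g) ∘ proj₁ (α X) ∎

  formulaToRan∘toFormula : ∀ X → formulaToRan₀ X 𝔼.∘ toFormula₀ X ≡ σ.η X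
  formulaToRan∘toFormula = Ran-unique K (formulaToRan ∘ᵥ toFormula) σ (begin
    c 𝔼.∘ (formulaToRan₀ Ŝ 𝔼.∘ toFormula₀ Ŝ)    ≡⟨ sym 𝔼.assoc ⟩
    (c 𝔼.∘ formulaToRan₀ Ŝ) 𝔼.∘ toFormula₀ Ŝ    ≡⟨ cong (𝔼._∘ toFormula₀ Ŝ) c∘formulaToRan ⟩
    Formula.proj Ŝ 𝔼.id 𝔼.∘ toFormula₀ Ŝ        ≡⟨ proj∘toFormula 𝔼.id ⟩
    ev 𝔼.id 𝔼.∘ σ.η Ŝ                           ≡⟨ cong (𝔼._∘ σ.η Ŝ) ev-id ⟩
    c 𝔼.∘ σ.η Ŝ                                 ∎)

  fromFormula∘toFormula : ∀ X → fromFormula₀ X 𝔼.∘ toFormula₀ X ≡ 𝔼.id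
  fromFormula∘toFormula = σ-unique (fromFormula ∘ᵥ toFormula) idNT
    (λ X → trans (cong₂ _∘_ (fromFormula-over X) (toFormula-over X)) identityˡ)
    (λ X → begin
      σ.η X 𝔼.∘ (fromFormula₀ X 𝔼.∘ toFormula₀ X)    ≡⟨ sym 𝔼.assoc ⟩
      (σ.η X 𝔼.∘ fromFormula₀ X) 𝔼.∘ toFormula₀ X    ≡⟨ cong (𝔼._∘ toFormula₀ X) (σ∘fromFormula X) ⟩
      formulaToRan₀ X 𝔼.∘ toFormula₀ X               ≡⟨ formulaToRan∘toFormula X ⟩
      σ.η X                                          ≡⟨ sym 𝔼.identityʳ ⟩
      σ.η X 𝔼.∘ 𝔼.id                                 ∎)

  toFormula∘fromFormula : ∀ X → toFormula₀ X 𝔼.∘ fromFormula₀ X ≡ 𝔼.id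
  toFormula∘fromFormula X = Formula.proj-jointly-monic _ _
    (trans (cong₂ _∘_ (toFormula-over X) (fromFormula-over X)) identityˡ) λ f → begin
      Formula.proj X f 𝔼.∘ (toFormula₀ X 𝔼.∘ fromFormula₀ X)
        ≡⟨ sym 𝔼.assoc ⟩
      (Formula.proj X f 𝔼.∘ toFormula₀ X) 𝔼.∘ fromFormula₀ X
        ≡⟨ cong (𝔼._∘ fromFormula₀ X) (proj∘toFormula f) ⟩
      (ev f 𝔼.∘ σ.η X) 𝔼.∘ fromFormula₀ X
        ≡⟨ 𝔼.assoc ⟩
      ev f 𝔼.∘ (σ.η X 𝔼.∘ fromFormula₀ X)
        ≡⟨ cong (ev f 𝔼.∘_) (σ∘fromFormula X) ⟩
      ev f 𝔼.∘ formulaToRan₀ X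
        ≡⟨ ev∘formulaToRan f ⟩
      Formula.proj X f
        ≡⟨ sym 𝔼.identityʳ ⟩
      Formula.proj X f 𝔼.∘ 𝔼.id ∎

proposition4p1 :
    ∀ {o ℓ : Level} (B : Category o ℓ) (D : Displayed B)
      (F : Fibration D) (FP : FibredProducts F) (BP : SmallProducts B)
      (M : Monad B) (R : Category.Obj B)
      (S : Displayed.Ob[_] D (Functor.F₀ (Monad.T M) R))
      (K : RanAlongSelf (Total D) (Functor.F₀ (Monad.T M) R , S))
      (L : CodensityLifting D M R S K)
      {A : Category.Obj B} (X : Displayed.Ob[_] D A) →
    VerticalIso D
      (FunctorOver.F₀′ (CodensityLifting.T⊤⊤ L) X)
      (FibredProducts.∏ FP
        (Category.Hom (Total D) (A , X) (Functor.F₀ (Monad.T M) R , S))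
        (λ f → Fibration._^*_ F
          (Category._∘_ B (NatTrans.η (Monad.μ M) R)
                          (Functor.F₁ (Monad.T M) (proj₁ f)))
          S))
proposition4p1 B D F FP BP M R S K L {A} X =
  verticalIso (toFormula₀ (A , X)) (toFormula-over (A , X))
              (fromFormula₀ (A , X)) (fromFormula-over (A , X))
              (fromFormula∘toFormula (A , X)) (toFormula∘fromFormula (A , X))
  where
    open Fibred D F FP using (verticalIso)
    open CodensityLiftingFormula B D F FP BP M R S K L
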